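{- Let $H$ be a graph and let $G$ be the graph obtained from $H$ by subdividing every edge of $H$ exactly twice (i.e., replacing each edge $xy$ of $H$ by a path $x\,a\,b\,y$ through two new vertices $a,b$ of degree $2$). Let $m=|E(G)|$. Then ${\rm I}_e(G)\geq \frac{1}{3}m$.
   Context: All graphs are finite and simple. A graph is locally irregular if no two adjacent vertices have the same degree. For a graph $G=(V,E)$, a set $S\subseteq E$ is an edge-irregulator of $G$ if the graph $G-S$ (obtained by deleting the edges of $S$) is locally irregular. ${\rm I}_e(G)$ denotes the minimum cardinality of an edge-irregulator of $G$. -}

module Defs where

open import Data.Nat using (ℕ; _+_; _*_; _≤_)
open import Data.Bool using (Bool; true; false; if_then_else_; _∨_)
open import Data.Fin using (Fin; _↑ˡ_; _↑ʳ_; splitAt)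
open import Data.Fin.Properties using () renaming (_≟_ to _≟ᶠ_)
open import Data.List using (List; map; allFin)
open import Data.Nat.ListAction using (sum)
open import Data.Product using (_×_; _,_; proj₁; proj₂)
open import Data.Sum using (inj₁; inj₂)
open import Relation.Nullary using (¬_)
open import Relation.Nullary.Decidable using (⌊_⌋)
open import Relation.Binary.PropositionalEquality using (_≡_; _≢_)

record Graph : Set where
  field
    n    : ℕ
    m    : ℕ
    ends : Fin m → Fin n × Fin n

open Graph public

Simple : Graph → Set
Simple G =
  (∀ e → proj₁ (ends G e) ≢ proj₂ (ends G e)) ×
  (∀ e f → e ≢ f →
     ¬ (ends G e ≡ ends G f) × ¬ (ends G e ≡ (proj₂ (ends G f) , proj₁ (ends G f))))

EdgeSet : Graph → Set
EdgeSet G = Fin (m G) → Bool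

∣_∣ₑ : {G : Graph} → EdgeSet G → ℕ
∣_∣ₑ {G} S = sum (map (λ e → if S e then 1 else 0) (allFin (m G)))

incident : (G : Graph) → Fin (n G) → Fin (m G) → Bool
incident G v e = ⌊ v ≟ᶠ proj₁ (ends G e) ⌋ ∨ ⌊ v ≟ᶠ proj₂ (ends G e) ⌋

degMinus : (G : Graph) → EdgeSet G → Fin (n G) → ℕ
degMinus G S v =
  sum (map (λ e → if S e then 0 else (if incident G v e then 1 else 0)) (allFin (m G)))

IsEdgeIrregulator : (G : Graph) → EdgeSet G → Set
IsEdgeIrregulator G S =
  ∀ e → S e ≡ false →
    degMinus G S (proj₁ (ends G e)) ≢ degMinus G S (proj₂ (ends G e))

-- Subdivide every edge exactly twice.  Vertices: original x (Fin n), then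
-- a_i, then b_i for each edge i.  Edges (3m of them): x_i a_i, a_i b_i, b_i y_i
-- where edge i of H is x_i y_i.
subdivide2 : Graph → Graph
subdivide2 H = record { n = N ; m = M + (M + M) ; ends = E }
  where
    N₀ = n H
    M  = m H
    N  = N₀ + (M + M)
    orig : Fin N₀ → Fin N
    orig x = x ↑ˡ (M + M)
    a : Fin M → Fin N
    a i = N₀ ↑ʳ (i ↑ˡ M)
    b : Fin M → Fin N
    b i = N₀ ↑ʳ (M ↑ʳ i)
    E : Fin (M + (M + M)) → Fin N × Fin N
    E j with splitAt M j
    ... | inj₁ i = orig (proj₁ (ends H i)) , a i
    ... | inj₂ j′ with splitAt M j′
    ...   | inj₁ i = a i , b i
    ...   | inj₂ i = b i , orig (proj₂ (ends H i))

-- For every edge xy of H, an edge-irregulator S of G must contain one of the three edges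
-- xa, ab, by of the path replacing it: otherwise the adjacent vertices a and b both keep
-- degree 2 in G - S.  These paths partition E(G), so |S| ≥ |E(H)| = |E(G)|/3.
module Submission where

open import Defs
open import Data.Nat.Properties using (+-0-commutativeMonoid; +-assoc; +-identityʳ; +-mono-≤; *-monoʳ-≤)
open import Algebra.Properties.CommutativeMonoid.Sum +-0-commutativeMonoid
  using (∑-distrib-+; sum-cong-≗; sum-remove; sum-replicate-zero)
  renaming (sum to ∑)
open import Data.Bool using (true; false; if_then_else_)
open import Data.Bool.Properties using (∨-zeroʳ)
open import Data.Fin using (Fin; zero; suc; _↑ˡ_; _↑ʳ_; splitAt; punchIn)
open import Data.Fin.Properties
  using (↑ˡ-injective; ↑ʳ-injective; splitAt-↑ˡ; splitAt-↑ʳ; punchInᵢ≢i)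
  renaming (_≟_ to _≟ᶠ_)
open import Data.List using (map; allFin; tabulate)
open import Data.List.Properties using (map-tabulate)
open import Data.Nat using (ℕ; zero; suc; _+_; _*_; _≤_; z≤n; s≤s)
open import Data.Nat.ListAction using (sum)
open import Data.Product using (_,_; proj₁; proj₂)
open import Data.Sum using (_⊎_; inj₁; inj₂)
open import Function using (_∘_; id)
open import Relation.Nullary using (contradiction)
open import Relation.Nullary.Decidable using (⌊_⌋; dec-true; dec-false; isYes≗does)
open import Relation.Binary.PropositionalEquality
open ≡-Reasoning

sum-tabulate : ∀ {k} (f : Fin k → ℕ) → sum (tabulate f) ≡ ∑ f
sum-tabulate {zero}  f = refl
sum-tabulate {suc k} f = cong (f zero +_) (sum-tabulate (f ∘ suc))

sum-map-allFin : ∀ {k} (f : Fin k → ℕ) → sum (map f (allFin k)) ≡ ∑ f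
sum-map-allFin f = trans (cong sum (map-tabulate id f)) (sum-tabulate f)

∑-split : ∀ k {l} (f : Fin (k + l) → ℕ) → ∑ f ≡ ∑ (f ∘ (_↑ˡ l)) + ∑ (f ∘ (k ↑ʳ_))
∑-split zero    f = refl
∑-split (suc k) f = trans (cong (f zero +_) (∑-split k (f ∘ suc))) (sym (+-assoc (f zero) _ _))

∑-zero : ∀ {k} (f : Fin k → ℕ) → (∀ j → f j ≡ 0) → ∑ f ≡ 0
∑-zero {k} f vanish = trans (sum-cong-≗ vanish) (sum-replicate-zero k)

∑-single : ∀ {k} (f : Fin k → ℕ) (i : Fin k) → (∀ j → j ≢ i → f j ≡ 0) → ∑ f ≡ f i
∑-single {suc k} f i vanish = begin
  ∑ f                        ≡⟨ sum-remove f ⟩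
  f i + ∑ (f ∘ punchIn i)    ≡⟨ cong (f i +_) (∑-zero _ (λ j → vanish _ (punchInᵢ≢i i j))) ⟩
  f i + 0                    ≡⟨ +-identityʳ (f i) ⟩
  f i                        ∎

n≤∑-of-positive : ∀ {k} (f : Fin k → ℕ) → (∀ j → 1 ≤ f j) → k ≤ ∑ f
n≤∑-of-positive {zero}  f pos = z≤n
n≤∑-of-positive {suc k} f pos = +-mono-≤ (pos zero) (n≤∑-of-positive (f ∘ suc) (pos ∘ suc))

↑ˡ≢↑ʳ : ∀ {k l} (i : Fin k) (j : Fin l) → i ↑ˡ l ≢ k ↑ʳ j
↑ˡ≢↑ʳ {k} {l} i j eq
  with () ← trans (sym (splitAt-↑ˡ k i l)) (trans (cong (splitAt k) eq) (splitAt-↑ʳ k l j))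

⌊≟⌋-true : ∀ {k} {x y : Fin k} → x ≡ y → ⌊ x ≟ᶠ y ⌋ ≡ true
⌊≟⌋-true {x = x} {y} x≡y = trans (isYes≗does (x ≟ᶠ y)) (dec-true (x ≟ᶠ y) x≡y)

⌊≟⌋-false : ∀ {k} {x y : Fin k} → x ≢ y → ⌊ x ≟ᶠ y ⌋ ≡ false
⌊≟⌋-false {x = x} {y} x≢y = trans (isYes≗does (x ≟ᶠ y)) (dec-false (x ≟ᶠ y) x≢y)

module _ (G : Graph) where

  incident-endpoint : ∀ {v e p q} → ends G e ≡ (p , q) → v ≡ p ⊎ v ≡ q → incident G v e ≡ true
  incident-endpoint eq (inj₁ v≡p) rewrite eq | ⌊≟⌋-true v≡p = refl
  incident-endpoint {v} {p = p} eq (inj₂ v≡q) rewrite eq | ⌊≟⌋-true v≡q = ∨-zeroʳ ⌊ v ≟ᶠ p ⌋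

  incident-outside : ∀ {v e p q} → ends G e ≡ (p , q) → v ≢ p → v ≢ q → incident G v e ≡ false
  incident-outside eq v≢p v≢q rewrite eq | ⌊≟⌋-false v≢p | ⌊≟⌋-false v≢q = refl

module _ (G : Graph) (S : EdgeSet G) where

  contribution : Fin (n G) → Fin (m G) → ℕ
  contribution v e = if S e then 0 else (if incident G v e then 1 else 0)

  contribution-endpoint : ∀ {v e p q} → ends G e ≡ (p , q) → v ≡ p ⊎ v ≡ q → S e ≡ false →
    contribution v e ≡ 1
  contribution-endpoint eq endpoint kept rewrite kept | incident-endpoint G eq endpoint = refl

  contribution-outside : ∀ {v e p q} → ends G e ≡ (p , q) → v ≢ p → v ≢ q →
    contribution v e ≡ 0
  contribution-outside {e = e} eq v≢p v≢q rewrite incident-outside G eq v≢p v≢q with S e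
  ... | true  = refl
  ... | false = refl

module Subdivision (H : Graph) where

  private
    N = n H
    M = m H

  G : Graph
  G = subdivide2 H

  outer : Fin N → Fin (n G)
  outer x = x ↑ˡ (M + M)

  inner₁ inner₂ : Fin M → Fin (n G)
  inner₁ i = N ↑ʳ (i ↑ˡ M)
  inner₂ i = N ↑ʳ (M ↑ʳ i)

  left middle right : Fin M → Fin (m G)
  left   i = i ↑ˡ (M + M)
  middle i = M ↑ʳ (i ↑ˡ M)
  right  i = M ↑ʳ (M ↑ʳ i)

  ends-left : ∀ i → ends G (left i) ≡ (outer (proj₁ (ends H i)) , inner₁ i)
  ends-left i rewrite splitAt-↑ˡ M i (M + M) = refl

  ends-middle : ∀ i → ends G (middle i) ≡ (inner₁ i , inner₂ i)
  ends-middle i rewrite splitAt-↑ʳ M (M + M) (i ↑ˡ M) | splitAt-↑ˡ M i M = refl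

  ends-right : ∀ i → ends G (right i) ≡ (inner₂ i , outer (proj₂ (ends H i)))
  ends-right i rewrite splitAt-↑ʳ M (M + M) (M ↑ʳ i) | splitAt-↑ʳ M M i = refl

  inner₁-injective : ∀ {i j} → inner₁ i ≡ inner₁ j → i ≡ j
  inner₁-injective = ↑ˡ-injective M _ _ ∘ ↑ʳ-injective N _ _

  inner₂-injective : ∀ {i j} → inner₂ i ≡ inner₂ j → i ≡ j
  inner₂-injective = ↑ʳ-injective M _ _ ∘ ↑ʳ-injective N _ _

  inner₁≢inner₂ : ∀ i j → inner₁ i ≢ inner₂ j
  inner₁≢inner₂ i j = ↑ˡ≢↑ʳ i j ∘ ↑ʳ-injective N _ _

  inner₁≢outer : ∀ i x → inner₁ i ≢ outer x
  inner₁≢outer i x = ↑ˡ≢↑ʳ x _ ∘ sym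

  inner₂≢outer : ∀ i x → inner₂ i ≢ outer x
  inner₂≢outer i x = ↑ˡ≢↑ʳ x _ ∘ sym

  ∑-edges : (f : Fin (m G) → ℕ) →
    sum (map f (allFin (m G))) ≡ ∑ (f ∘ left) + (∑ (f ∘ middle) + ∑ (f ∘ right))
  ∑-edges f = begin
    sum (map f (allFin (m G)))            ≡⟨ sum-map-allFin f ⟩
    ∑ f                                   ≡⟨ ∑-split M f ⟩
    ∑ (f ∘ left) + ∑ (f ∘ (M ↑ʳ_))        ≡⟨ cong (∑ (f ∘ left) +_) (∑-split M (f ∘ (M ↑ʳ_))) ⟩
    ∑ (f ∘ left) + (∑ (f ∘ middle) + ∑ (f ∘ right)) ∎

  module _ (S : EdgeSet G) where

    degree-inner₁ : ∀ i → S (left i) ≡ false → S (middle i) ≡ false → degMinus G S (inner₁ i) ≡ 2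
    degree-inner₁ i keptˡ keptᵐ = begin
      degMinus G S v                                ≡⟨ ∑-edges (c v) ⟩
      ∑ (c v ∘ left) + (∑ (c v ∘ middle) + ∑ (c v ∘ right))
        ≡⟨ cong₂ _+_ (∑-single _ i onlyˡ) (cong₂ _+_ (∑-single _ i onlyᵐ) (∑-zero _ noneʳ)) ⟩
      c v (left i) + (c v (middle i) + 0)
        ≡⟨ cong₂ _+_ (contribution-endpoint G S (ends-left i) (inj₂ refl) keptˡ)
                     (cong (_+ 0) (contribution-endpoint G S (ends-middle i) (inj₁ refl) keptᵐ)) ⟩
      2                                             ∎
      where
        v = inner₁ i
        c = contribution G S
        onlyˡ : ∀ j → j ≢ i → c v (left j) ≡ 0
        onlyˡ j j≢i =
          contribution-outside G S (ends-left j) (inner₁≢outer i _) (j≢i ∘ sym ∘ inner₁-injective)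
        onlyᵐ : ∀ j → j ≢ i → c v (middle j) ≡ 0
        onlyᵐ j j≢i =
          contribution-outside G S (ends-middle j) (j≢i ∘ sym ∘ inner₁-injective) (inner₁≢inner₂ i j)
        noneʳ : ∀ j → c v (right j) ≡ 0
        noneʳ j = contribution-outside G S (ends-right j) (inner₁≢inner₂ i j) (inner₁≢outer i _)

    degree-inner₂ : ∀ i → S (middle i) ≡ false → S (right i) ≡ false → degMinus G S (inner₂ i) ≡ 2
    degree-inner₂ i keptᵐ keptʳ = begin
      degMinus G S v                                ≡⟨ ∑-edges (c v) ⟩
      ∑ (c v ∘ left) + (∑ (c v ∘ middle) + ∑ (c v ∘ right))
        ≡⟨ cong₂ _+_ (∑-zero _ noneˡ) (cong₂ _+_ (∑-single _ i onlyᵐ) (∑-single _ i onlyʳ)) ⟩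
      0 + (c v (middle i) + c v (right i))
        ≡⟨ cong₂ _+_ (contribution-endpoint G S (ends-middle i) (inj₂ refl) keptᵐ)
                     (contribution-endpoint G S (ends-right i) (inj₁ refl) keptʳ) ⟩
      2                                             ∎
      where
        v = inner₂ i
        c = contribution G S
        noneˡ : ∀ j → c v (left j) ≡ 0
        noneˡ j = contribution-outside G S (ends-left j) (inner₂≢outer i _) (inner₁≢inner₂ j i ∘ sym)
        onlyᵐ : ∀ j → j ≢ i → c v (middle j) ≡ 0
        onlyᵐ j j≢i =
          contribution-outside G S (ends-middle j) (inner₁≢inner₂ j i ∘ sym) (j≢i ∘ sym ∘ inner₂-injective)
        onlyʳ : ∀ j → j ≢ i → c v (right j) ≡ 0
        onlyʳ j j≢i =
          contribution-outside G S (ends-right j) (j≢i ∘ sym ∘ inner₂-injective) (inner₂≢outer i _)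

    removed : Fin (m G) → ℕ
    removed e = if S e then 1 else 0

    irregulator-meets-every-path : IsEdgeIrregulator G S →
      ∀ i → 1 ≤ removed (left i) + (removed (middle i) + removed (right i))
    irregulator-meets-every-path irregular i
      with S (left i) in keptˡ | S (middle i) in keptᵐ | S (right i) in keptʳ
    ... | true  | _     | _     = s≤s z≤n
    ... | false | true  | _     = s≤s z≤n
    ... | false | false | true  = s≤s z≤n
    ... | false | false | false = contradiction
      (trans (degree-inner₁ i keptˡ keptᵐ) (sym (degree-inner₂ i keptᵐ keptʳ)))
      (subst (λ (x , y) → degMinus G S x ≢ degMinus G S y) (ends-middle i) (irregular (middle i) keptᵐ))

    ∣S∣ₑ≡∑-over-paths : ∣_∣ₑ {G} S ≡ ∑ (λ i → removed (left i) + (removed (middle i) + removed (right i)))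
    ∣S∣ₑ≡∑-over-paths = begin
      ∣_∣ₑ {G} S
        ≡⟨ ∑-edges removed ⟩
      ∑ (removed ∘ left) + (∑ (removed ∘ middle) + ∑ (removed ∘ right))
        ≡⟨ cong (∑ (removed ∘ left) +_) (∑-distrib-+ (removed ∘ middle) (removed ∘ right)) ⟨
      ∑ (removed ∘ left) + ∑ (λ i → removed (middle i) + removed (right i))
        ≡⟨ ∑-distrib-+ (removed ∘ left) _ ⟨
      ∑ (λ i → removed (left i) + (removed (middle i) + removed (right i))) ∎

    m≤∣irregulator∣ : IsEdgeIrregulator G S → M ≤ ∣_∣ₑ {G} S
    m≤∣irregulator∣ irregular =
      subst (M ≤_) (sym ∣S∣ₑ≡∑-over-paths) (n≤∑-of-positive _ (irregulator-meets-every-path irregular))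

theorem1 : (H : Graph) → Simple H →
    (S : EdgeSet (subdivide2 H)) → IsEdgeIrregulator (subdivide2 H) S →
    m (subdivide2 H) ≤ 3 * ∣_∣ₑ {subdivide2 H} S
theorem1 H _ S irregular =
  subst (_≤ 3 * ∣_∣ₑ {subdivide2 H} S) (cong (λ k → m H + (m H + k)) (+-identityʳ (m H)))
    (*-monoʳ-≤ 3 (Subdivision.m≤∣irregulator∣ H S irregular))
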